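{- For every global type $G$ and network $N$, if $\vdash G\triangleright N$ then $\mathrm{plays}(G)=\mathrm{plays}(N)$.
   Context: Participants are ranged over by $\mathsf p,\mathsf q,\mathsf r$ and labels by $\lambda$. Processes are the possibly infinite but regular terms coinductively generated by $P ::= \mathbf 0 \mid \mathsf p!\{\lambda_i;P_i\}_{i\in I}\mid \mathsf p?\{\lambda_i;P_i\}_{i\in I}$, with $I$ finite and nonempty and the $\lambda_i$ pairwise distinct. A network is $N=\mathsf p_1[\![P_1]\!]\parallel\cdots\parallel\mathsf p_n[\![P_n]\!]$ with $n>0$ and pairwise distinct $\mathsf p_i$; networks are taken modulo permutation and adding/removing components $\mathsf p[\![\mathbf 0]\!]$. $\mathrm{plays}(N)$ is the set of $\mathsf p$ such that $N\equiv\mathsf p[\![P]\!]\parallel N'$ with $P\neq\mathbf 0$. Global types are the possibly infinite regular terms coinductively generated by $G ::= \mathsf{End}\mid \mathsf p\mathsf q!\{\lambda_i;G_i\}_{i\in I}\mid\mathsf p\mathsf q?\{\lambda_i;G_i\}_{i\in I}$ ($I$ finite nonempty, $\mathsf p\neq\mathsf q$, $\lambda_i$ pairwise distinct). Set $\mathrm{play}(\mathsf p\mathsf q!\{\ldots\})=\mathsf p$, $\mathrm{play}(\mathsf p\mathsf q?\{\ldots\})=\mathsf q$; $\mathrm{plays}(G)$ is the least set with $\mathrm{plays}(\mathsf{End})=\emptyset$ and $\mathrm{plays}(G)=\{\mathrm{play}(G)\}\cup\bigcup_{i\in I}\mathrm{plays}(G_i)$ for $G$ a choice with continuations $G_i$.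 The typing judgement $\vdash G\triangleright N$ is defined coinductively (derivations may be infinite) by: (End) $\vdash\mathsf{End}\triangleright\mathsf p[\![\mathbf 0]\!]$; (Out) if for all $i\in I$, $\vdash G_i\triangleright\mathsf p[\![P_i]\!]\parallel N$ and $\mathrm{plays}(G_i)\setminus\{\mathsf p\}=\mathrm{plays}(N)$, then $\vdash\mathsf p\mathsf q!\{\lambda_i;G_i\}_{i\in I}\triangleright\mathsf p[\![\mathsf q!\{\lambda_i;P_i\}_{i\in I}]\!]\parallel N$; (In) if $I\subseteq J$ and for all $i\in I$, $\vdash G_i\triangleright\mathsf p[\![P_i]\!]\parallel N$ and $\mathrm{plays}(G_i)\setminus\{\mathsf p\}=\mathrm{plays}(N)$, then $\vdash\mathsf q\mathsf p?\{\lambda_i;G_i\}_{i\in I}\triangleright\mathsf p[\![\mathsf q?\{\lambda_j;P_j\}_{j\in J}]\!]\parallel N$. -}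

module Defs where

open import Level using (Level; 0ℓ) renaming (suc to lsuc)
open import Data.Nat using (ℕ; suc; _≟_)
open import Data.Fin using (Fin; zero)
open import Data.Empty using (⊥)
open import Data.Unit using (⊤)
open import Data.Product using (Σ; ∃; _×_)
open import Data.List using (List)
open import Data.List.Membership.Propositional using (_∈_)
open import Relation.Nullary using (¬_; yes; no)
open import Relation.Binary.PropositionalEquality using (_≡_; _≢_)
open import Function.Definitions using (Injective)

-- Participants and labels are drawn from countably infinite sets; we use ℕ.
Participant : Set
Participant = ℕ

Label : Set
Label = ℕ

data Dir : Set where
  out inp : Dir

-- Regular (possibly infinite) terms are represented as finite graphs
-- (finite systems of equations) with a root; the term is the unfolding.
-- A choice  †{λ_i ; _}_{i∈I}  has I = Fin (suc n) (finite, nonempty)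
-- and an injective labelling (labels pairwise distinct).

data ProcShape (k : ℕ) : Set where
  end : ProcShape k
  act : (d : Dir) (q : Participant) (n : ℕ) (lab : Fin (suc n) → Label) →
        Injective _≡_ _≡_ lab → (Fin (suc n) → Fin k) → ProcShape k

record Process : Set where
  field
    size : ℕ
    node : Fin size → ProcShape size
    root : Fin size

open Process public

shape : (P : Process) → ProcShape (size P)
shape P = node P (root P)

at : (P : Process) → Fin (size P) → Process
at P x = record { size = size P ; node = node P ; root = x }

zeroP : Process
zeroP = record { size = 1 ; node = λ _ → end ; root = zero }

ActiveS : ∀ {k} → ProcShape k → Set
ActiveS end = ⊥
ActiveS (act _ _ _ _ _ _) = ⊤

Active : Process → Set
Active P = ActiveS (shape P)

-- Networks: a network modulo permutation and 0-components is exactly a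
-- map from participants to processes (0 almost everywhere).

Network : Set
Network = Participant → Process

_∈playsN_ : Participant → Network → Set
r ∈playsN N = Active (N r)

FiniteSupport : Network → Set
FiniteSupport N = Σ (List Participant) λ L → ∀ r → Active (N r) → r ∈ L

-- p[[P]] ∥ (N without p)
_[_≔_] : Network → Participant → Process → Network
(N [ p ≔ P ]) r with r ≟ p
... | yes _ = P
... | no _ = N r

_∖_ : Network → Participant → Network
N ∖ p = N [ p ≔ zeroP ]

-- Global types
--   gact out p q ...  is  pq!{λ_i ; G_i}
--   gact inp p q ...  is  pq?{λ_i ; G_i}

data GShape (k : ℕ) : Set where
  End  : GShape k
  gact : (d : Dir) (p q : Participant) → p ≢ q → (n : ℕ)
         (lab : Fin (suc n) → Label) → Injective _≡_ _≡_ lab →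
         (Fin (suc n) → Fin k) → GShape k

record GType : Set where
  field
    gsize : ℕ
    gnode : Fin gsize → GShape gsize
    groot : Fin gsize

open GType public

gshape : (G : GType) → GShape (gsize G)
gshape G = gnode G (groot G)

gat : (G : GType) → Fin (gsize G) → GType
gat G x = record { gsize = gsize G ; gnode = gnode G ; groot = x }

IsPlay : ∀ {k} → Participant → GShape k → Set
IsPlay r End = ⊥
IsPlay r (gact out p q _ _ _ _ _) = r ≡ p
IsPlay r (gact inp p q _ _ _ _ _) = r ≡ q

Child : ∀ {k} → GShape k → Set
Child End = ⊥
Child (gact _ _ _ _ n _ _ _) = Fin (suc n)

childIx : ∀ {k} (S : GShape k) → Child S → Fin k
childIx (gact _ _ _ _ _ _ _ ks) i = ks i

child : (G : GType) → Child (gshape G) → GType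
child G c = gat G (childIx (gshape G) c)

data _∈plays_ (r : Participant) (G : GType) : Set where
  here  : IsPlay r (gshape G) → r ∈plays G
  there : (c : Child (gshape G)) → r ∈plays child G c → r ∈plays G

PlaysCond : GType → Participant → Network → Set
PlaysCond G p N' = ∀ r → ((r ∈plays G × r ≢ p) → r ∈playsN N')
                       × (r ∈playsN N' → (r ∈plays G × r ≢ p))

-- One step of the typing rules, with the premises judged by R.

Judgement : Set₁
Judgement = GType → Network → Set

OutAt : Judgement → (p q : Participant) (n : ℕ) (lab : Fin (suc n) → Label)
        (Gs : Fin (suc n) → GType) (N : Network) → (P : Process) → ProcShape (size P) → Set
OutAt R p q n lab Gs N P end = ⊥
OutAt R p q n lab Gs N P (act inp _ _ _ _ _) = ⊥
OutAt R p q n lab Gs N P (act out q' m labP _ Ps) =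
  q' ≡ q
  × (∀ i → ∃ λ j → lab i ≡ labP j)
  × (∀ j → ∃ λ i → lab i ≡ labP j)
  × (∀ i j → lab i ≡ labP j →
       R (Gs i) (N [ p ≔ at P (Ps j) ]) × PlaysCond (Gs i) p (N ∖ p))

InAt : Judgement → (p q : Participant) (n : ℕ) (lab : Fin (suc n) → Label)
       (Gs : Fin (suc n) → GType) (N : Network) → (P : Process) → ProcShape (size P) → Set
InAt R p q n lab Gs N P end = ⊥
InAt R p q n lab Gs N P (act out _ _ _ _ _) = ⊥
InAt R p q n lab Gs N P (act inp q' m labP _ Ps) =
  q' ≡ q
  × (∀ i → ∃ λ j → lab i ≡ labP j)
  × (∀ i j → lab i ≡ labP j →
       R (Gs i) (N [ p ≔ at P (Ps j) ]) × PlaysCond (Gs i) p (N ∖ p))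

RuleS : Judgement → (G : GType) → GShape (gsize G) → Network → Set
RuleS R G End N = ∀ r → ¬ Active (N r)
-- (Out): G = pq!{λ_i;G_i}, N = p[[q!{λ_i;P_i}]] ∥ N'
RuleS R G (gact out p q _ n lab _ ks) N =
  OutAt R p q n lab (λ i → gat G (ks i)) N (N p) (shape (N p))
-- (In): G = qp?{λ_i;G_i}, N = p[[q?{λ_j;P_j}]] ∥ N'
RuleS R G (gact inp q p _ n lab _ ks) N =
  InAt R p q n lab (λ i → gat G (ks i)) N (N p) (shape (N p))

Rule : Judgement → Judgement
Rule R G N = RuleS R G (gshape G) N

Consistent : Judgement → Set
Consistent R = ∀ G N → R G N → Rule R G N

-- coinductive typing: the greatest fixed point of Rule
⊢_▷_ : GType → Network → Set₁
⊢ G ▷ N = Σ Judgement λ R → Consistent R × R G N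

{-# OPTIONS --safe #-}
module Submission where

open import Defs
open import Data.Product using (_×_; _,_; proj₁; proj₂; ∃)
open import Data.Sum using (_⊎_; inj₁; inj₂)
open import Data.Nat using (ℕ; suc; _≟_)
open import Data.Fin using (Fin; zero)
open import Data.Empty using (⊥-elim)
open import Function.Bundles using (_⇔_; mk⇔; Equivalence)
open import Function.Properties.Equivalence using () renaming (trans to ⇔-trans)
open import Relation.Nullary using (yes; no)
open import Relation.Binary.PropositionalEquality using (_≡_; _≢_; refl; subst; sym)

-- A single application of the typing rule at the root already decides plays(G):
-- if p plays the root communication, then p is active in N and, for every
-- branch i, plays(G_i) \ {p} = plays(N) \ {p} by the side condition of the rule.
-- Hence plays(N) = {p} ∪ plays(G_i) for each i, and since I is nonempty,
-- plays(N) = {p} ∪ ⋃ᵢ plays(G_i) = plays(G).  If G = End, both sets are empty.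

[≔]-≢ : ∀ (N : Network) {p r} (P : Process) → r ≢ p → (N [ p ≔ P ]) r ≡ N r
[≔]-≢ N {p} {r} P r≢p with r ≟ p
... | yes r≡p = ⊥-elim (r≢p r≡p)
... | no _ = refl

∈playsN-insert : ∀ {G p N} → p ∈playsN N → PlaysCond G p (N ∖ p) →
                 ∀ r → r ∈playsN N ⇔ (r ≡ p ⊎ r ∈plays G)
∈playsN-insert {G} {p} {N} p-active cond r = mk⇔ to from
  where
  to : r ∈playsN N → r ≡ p ⊎ r ∈plays G
  to r-active with r ≟ p
  ... | yes r≡p = inj₁ r≡p
  ... | no r≢p = inj₂ (proj₁ (proj₂ (cond r) (subst Active (sym ([≔]-≢ N zeroP r≢p)) r-active)))

  from : r ≡ p ⊎ r ∈plays G → r ∈playsN N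
  from (inj₁ refl) = p-active
  from (inj₂ r∈G) with r ≟ p
  ... | yes refl = p-active
  ... | no r≢p = subst Active ([≔]-≢ N zeroP r≢p) (proj₁ (cond r) (r∈G , r≢p))

module _ {R : Judgement} {p q : Participant} {n : ℕ} {lab : Fin (suc n) → Label}
         {Gs : Fin (suc n) → GType} {N : Network} {P : Process} where

  OutAt-active : (S : ProcShape (size P)) → OutAt R p q n lab Gs N P S → ActiveS S
  OutAt-active (act out _ _ _ _ _) _ = _

  OutAt-branch : (S : ProcShape (size P)) → OutAt R p q n lab Gs N P S →
                 ∀ i → PlaysCond (Gs i) p (N ∖ p)
  OutAt-branch (act out _ _ _ _ _) (_ , covered , _ , premises) i =
    let (j , same-label) = covered i in proj₂ (premises i j same-label)

  InAt-active : (S : ProcShape (size P)) → InAt R p q n lab Gs N P S → ActiveS S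
  InAt-active (act inp _ _ _ _ _) _ = _

  InAt-branch : (S : ProcShape (size P)) → InAt R p q n lab Gs N P S →
                ∀ i → PlaysCond (Gs i) p (N ∖ p)
  InAt-branch (act inp _ _ _ _ _) (_ , covered , premises) i =
    let (j , same-label) = covered i in proj₂ (premises i j same-label)

module _ {R : Judgement} {G : GType} {N : Network} where

  RuleS-branch : (S : GShape (gsize G)) → RuleS R G S N → (c : Child S) →
                 ∀ r → r ∈playsN N ⇔ (IsPlay r S ⊎ r ∈plays gat G (childIx S c))
  RuleS-branch (gact out p _ _ _ _ _ _) h c =
    ∈playsN-insert (OutAt-active (shape (N p)) h) (OutAt-branch (shape (N p)) h c)
  RuleS-branch (gact inp _ p _ _ _ _ _) h c =
    ∈playsN-insert (InAt-active (shape (N p)) h) (InAt-branch (shape (N p)) h c)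

  RuleS-plays : (S : GShape (gsize G)) → RuleS R G S N → ∀ r →
                (IsPlay r S ⊎ ∃ λ c → r ∈plays gat G (childIx S c)) ⇔ r ∈playsN N
  RuleS-plays End h r = mk⇔ (λ { (inj₁ ()) ; (inj₂ (() , _)) }) (λ r-active → ⊥-elim (h r r-active))
  RuleS-plays S@(gact _ _ _ _ _ _ _ _) h r = mk⇔ to from
    where
    to : IsPlay r S ⊎ (∃ λ c → r ∈plays gat G (childIx S c)) → r ∈playsN N
    to (inj₁ r-plays) = Equivalence.from (RuleS-branch S h zero r) (inj₁ r-plays)
    to (inj₂ (c , r∈Gc)) = Equivalence.from (RuleS-branch S h c r) (inj₂ r∈Gc)

    from : r ∈playsN N → IsPlay r S ⊎ ∃ λ c → r ∈plays gat G (childIx S c)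
    from r-active with Equivalence.to (RuleS-branch S h zero r) r-active
    ... | inj₁ r-plays = inj₁ r-plays
    ... | inj₂ r∈G₀ = inj₂ (zero , r∈G₀)

∈plays-unfold : ∀ G r → r ∈plays G ⇔ (IsPlay r (gshape G) ⊎ ∃ λ c → r ∈plays child G c)
∈plays-unfold G r = mk⇔ to from
  where
  to : r ∈plays G → IsPlay r (gshape G) ⊎ ∃ λ c → r ∈plays child G c
  to (here r-plays) = inj₁ r-plays
  to (there c r∈Gc) = inj₂ (c , r∈Gc)

  from : IsPlay r (gshape G) ⊎ (∃ λ c → r ∈plays child G c) → r ∈plays G
  from (inj₁ r-plays) = here r-plays
  from (inj₂ (c , r∈Gc)) = there c r∈Gc

lemma3p2 : (G : GType) (N : Network) → FiniteSupport N → ⊢ G ▷ N →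
           ∀ r → (r ∈plays G → r ∈playsN N) × (r ∈playsN N → r ∈plays G)
lemma3p2 G N _ (R , consistent , typed) r = Equivalence.to plays≡ , Equivalence.from plays≡
  where
  plays≡ : r ∈plays G ⇔ r ∈playsN N
  plays≡ = ⇔-trans (∈plays-unfold G r) (RuleS-plays (gshape G) (consistent G N typed) r)
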